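{- Let $G$ be a finite simple graph with $\delta(G)\geq 1$ and let $M(G)$ be its Mycielskian. Then $G$ belongs to Class 1 if and only if $\chi_d^t(M(G))=\chi_d^t(G)+1$.
   Context: All graphs are finite, undirected and simple. A total dominator coloring (TDC) of $G$ is a proper coloring of $G$ in which every vertex of $G$ is adjacent to every vertex of some color class; $\chi_d^t(G)$ is the minimum number of color classes in a TDC of $G$, and a $\chi_d^t$-coloring is a TDC with $\chi_d^t(G)$ colors. For a TDC $f=(V_1,\dots,V_\ell)$ (with $V_i$ the color classes), write $v\succ V_i$ if $v$ is adjacent to all vertices of $V_i$. A vertex $v$ is a private neighbor of $V_i$ with respect to $f$ if $v\succ V_i$ and $v\not\succ V_j$ for all $j\neq i$; the set of these is $pn_G(V_i;f)$. $G$ belongs to Class 1 if it has a $\chi_d^t$-coloring $f=(V_1,\dots,V_\ell)$ with $pn_G(V_i;f)=\emptyset$ for some $i$, and to Class 2 otherwise. If $V(G)=\{v_1,\dots,v_n\}$, the Mycielskian $M(G)$ has vertex set $V(G)\cup\{u_1,\dots,u_n\}\cup\{w\}$ and edge set $E(G)\cup\{u_iv_j : v_iv_j\in E(G)\}\cup\{u_iw : 1\le i\le n\}$. -}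

module Defs where

open import Data.Nat using (ℕ; suc; _+_; _<_)
open import Data.Fin using (Fin; splitAt)
open import Data.Bool using (Bool; true; false)
open import Data.Sum using (_⊎_; inj₁; inj₂)
open import Data.Product using (Σ; _×_; ∃; ∃-syntax; _,_)
open import Relation.Binary.PropositionalEquality using (_≡_; _≢_; refl)
open import Relation.Nullary using (¬_)

record Graph (n : ℕ) : Set where
  field
    Adj   : Fin n → Fin n → Bool
    sym   : ∀ x y → Adj x y ≡ Adj y x
    irrefl : ∀ x → Adj x x ≡ false
open Graph public

module _ {n : ℕ} (G : Graph n) where

  _~_ : Fin n → Fin n → Set
  x ~ y = Adj G x y ≡ true

  MinDegPos : Set
  MinDegPos = ∀ x → ∃[ y ] (x ~ y)

  -- A coloring with exactly k (nonempty) color classes V_0..V_{k-1}: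
  -- c : Fin n → Fin k surjective; V_i = c⁻¹(i).
  Surjective : {k : ℕ} → (Fin n → Fin k) → Set
  Surjective {k} c = ∀ (i : Fin k) → ∃[ x ] (c x ≡ i)

  Proper : {k : ℕ} → (Fin n → Fin k) → Set
  Proper c = ∀ x y → x ~ y → c x ≢ c y

  Dom : {k : ℕ} → (Fin n → Fin k) → Fin n → Fin k → Set
  Dom c v i = ∀ x → c x ≡ i → v ~ x

  IsTDC : {k : ℕ} → (Fin n → Fin k) → Set
  IsTDC c = Surjective c × Proper c × (∀ v → ∃[ i ] Dom c v i)

  HasTDC : ℕ → Set
  HasTDC k = Σ (Fin n → Fin k) IsTDC

  IsChiDT : ℕ → Set
  IsChiDT k = HasTDC k × (∀ m → m < k → ¬ HasTDC m)

  PrivNbr : {k : ℕ} → (Fin n → Fin k) → Fin k → Fin n → Set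
  PrivNbr c i v = Dom c v i × (∀ j → j ≢ i → ¬ Dom c v j)

  Class1 : Set
  Class1 = ∃[ k ] (IsChiDT k × ∃[ c ] (IsTDC {k} c × ∃[ i ] (∀ v → ¬ PrivNbr c i v)))

data MV (n : ℕ) : Set where
  vv : Fin n → MV n
  uu : Fin n → MV n
  ww : MV n

myAdj : {n : ℕ} → Graph n → MV n → MV n → Bool
myAdj G (vv i) (vv j) = Adj G i j
myAdj G (vv i) (uu j) = Adj G j i
myAdj G (vv i) ww     = false
myAdj G (uu i) (vv j) = Adj G i j
myAdj G (uu i) (uu j) = false
myAdj G (uu i) ww     = true
myAdj G ww (vv j)     = false
myAdj G ww (uu j)     = true
myAdj G ww ww         = false

myAdj-sym : {n : ℕ} (G : Graph n) → ∀ a b → myAdj G a b ≡ myAdj G b a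
myAdj-sym G (vv i) (vv j) = sym G i j
myAdj-sym G (vv i) (uu j) = refl
myAdj-sym G (vv i) ww     = refl
myAdj-sym G (uu i) (vv j) = refl
myAdj-sym G (uu i) (uu j) = refl
myAdj-sym G (uu i) ww     = refl
myAdj-sym G ww (vv j)     = refl
myAdj-sym G ww (uu j)     = refl
myAdj-sym G ww ww         = refl

myAdj-irrefl : {n : ℕ} (G : Graph n) → ∀ a → myAdj G a a ≡ false
myAdj-irrefl G (vv i) = irrefl G i
myAdj-irrefl G (uu i) = refl
myAdj-irrefl G ww     = refl

-- Fin (n + (n + 1)) : first n are v_1..v_n, next n are u_1..u_n, last is w
classify : {n : ℕ} → Fin (n + (n + 1)) → MV n
classify {n} x with splitAt n x
... | inj₁ i = vv i
... | inj₂ y with splitAt n {1} y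
...   | inj₁ j = uu j
...   | inj₂ _ = ww

M : {n : ℕ} → Graph n → Graph (n + (n + 1))
M G = record
  { Adj    = λ x y → myAdj G (classify x) (classify y)
  ; sym    = λ x y → myAdj-sym G (classify x) (classify y)
  ; irrefl = λ x → myAdj-irrefl G (classify x)
  }

module Submission where

-- If f is a χ_d^t-colouring of G whose class V_i has no private neighbours, colouring v_x by f x,
-- w by i and all u_x by one new colour is a TDC of M(G): w dominates the new class and every
-- vertex of G dominates some class other than V_i, hence so do v_x and u_x.
-- Conversely, a TDC of M(G) with m colours induces a colouring h of G by the colours of the v's
-- (when no v shares w's colour, v_r is first recoloured with col (u_r) for one r per colour used
-- by u's only). It is proper, every vertex dominates an h-class, and it misses a colour (that of
-- w, or the class dominated by w), so compressing it gives a TDC of G with fewer than m colours.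
-- If m = χ_d^t(G) + 1, h cannot miss a second colour (compressing would beat χ_d^t(G)), and this
-- forces an h-class that no vertex dominates alone, i.e. one without private neighbours.

open import Defs
open import Data.Nat.Properties using (<-irrefl; ≮⇒≥; ≤-antisym; ≤-<-trans; ≤-pred; +-comm)
open import Data.Nat using (ℕ; zero; suc; _+_; _≤_; _<_; s≤s)
open import Data.Fin using (Fin; zero; suc; punchIn; punchOut; splitAt; _↑ˡ_; _↑ʳ_)
import Data.Fin.Properties as Finₚ
open import Data.Product using (_×_; ∃-syntax; _,_; proj₁; proj₂)
open import Function using (id; _∘_)
open import Function.Definitions using (Injective)
open import Function.Bundles using (_⇔_; mk⇔)
open import Data.Bool using (true; false)
open import Data.Maybe using (Maybe; just; nothing)
import Data.Maybe.Properties as Maybeₚ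
import Data.Bool.Properties as Boolₚ
open import Data.Empty using (⊥; ⊥-elim)
open import Data.Sum using (_⊎_; inj₁; inj₂)
open import Relation.Nullary using (¬_; Dec; yes; no)
open import Relation.Nullary.Decidable using (¬?; _×-dec_; _→-dec_)
open import Relation.Binary.PropositionalEquality
  using (_≡_; _≢_; refl; trans; cong; subst; subst₂) renaming (sym to ≡-sym)

record ImageFactorisation {n m : ℕ} (h : Fin n → Fin m) : Set where
  field
    size            : ℕ
    onto            : Fin n → Fin size
    onto-surjective : ∀ i → ∃[ x ] (onto x ≡ i)
    into            : Fin size → Fin m
    into-injective  : Injective _≡_ _≡_ into
    into∘onto       : ∀ x → into (onto x) ≡ h x

identityFactorisation : ∀ {n m} {h : Fin n → Fin m} → (∀ i → ∃[ x ] (h x ≡ i)) → ImageFactorisation h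
identityFactorisation {m = m} {h} surjective = record
  { size = m ; onto = h ; onto-surjective = surjective ; into = id ; into-injective = id ; into∘onto = λ _ → refl }

imageFactorisation : ∀ {n m} (h : Fin n → Fin m) → ImageFactorisation h
imageFactorisation {m = zero} h = identityFactorisation (λ ())
imageFactorisation {m = suc m} h with Finₚ.all? (λ i → Finₚ.any? (λ x → h x Finₚ.≟ i))
... | yes surjective = identityFactorisation surjective
... | no ¬surjective with Finₚ.¬∀⟶∃¬ (suc m) _ (λ i → Finₚ.any? (λ x → h x Finₚ.≟ i)) ¬surjective
...   | c , c∉image = record
  { size = size ; onto = onto ; onto-surjective = onto-surjective
  ; into = punchIn c ∘ into
  ; into-injective = into-injective ∘ Finₚ.punchIn-injective c _ _
  ; into∘onto = λ x → trans (cong (punchIn c) (into∘onto x)) (Finₚ.punchIn-punchOut (c≢h x))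
  }
  where
  c≢h : ∀ x → c ≢ h x
  c≢h x c≡hx = c∉image (x , ≡-sym c≡hx)
  open ImageFactorisation (imageFactorisation (λ x → punchOut (c≢h x)))

module _ {k m : ℕ} {e : Fin k → Fin (suc m)} (e-injective : Injective _≡_ _≡_ e)
         {c : Fin (suc m)} (c∉e : ∀ i → c ≢ e i) where

  squeeze : Fin k → Fin m
  squeeze i = punchOut (c∉e i)

  squeeze-injective : Injective _≡_ _≡_ squeeze
  squeeze-injective eq = e-injective (Finₚ.punchOut-injective (c∉e _) (c∉e _) eq)

injective-missing⇒< : ∀ {k m} {e : Fin k → Fin m} → Injective _≡_ _≡_ e →
                      (c : Fin m) → (∀ i → c ≢ e i) → k < m
injective-missing⇒< {m = suc m} e-injective c c∉e = s≤s (Finₚ.injective⇒≤ (squeeze-injective e-injective c∉e))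

injective-missing-two⇒< : ∀ {k m} {e : Fin k → Fin m} → Injective _≡_ _≡_ e →
                          {c₁ c₂ : Fin m} → c₁ ≢ c₂ → (∀ i → c₁ ≢ e i) → (∀ i → c₂ ≢ e i) → suc k < m
injective-missing-two⇒< {m = suc m} e-injective c₁≢c₂ c₁∉e c₂∉e =
  s≤s (injective-missing⇒< (squeeze-injective e-injective c₁∉e) (punchOut c₁≢c₂)
         (λ i eq → c₂∉e i (Finₚ.punchOut-injective c₁≢c₂ (c₁∉e i) eq)))

module _ {n : ℕ} (G : Graph n) where

  ClassDominating : ∀ {m} → (Fin n → Fin m) → Set
  ClassDominating h = ∀ v → ∃[ y ] Dom G h v (h y)

  OtherClassDominated : ∀ {m} → (Fin n → Fin m) → Fin n → Set
  OtherClassDominated h y₀ = ∀ v → ∃[ y ] (h y ≢ h y₀ × Dom G h v (h y))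

  Missed : ∀ {m} → (Fin n → Fin m) → Fin m → Set
  Missed h c = ∀ y → h y ≢ c

  TwoMissed : ∀ {m} → (Fin n → Fin m) → Set
  TwoMissed h = ∃[ c₁ ] ∃[ c₂ ] (c₁ ≢ c₂ × Missed h c₁ × Missed h c₂)

  record InheritedColouring {m : ℕ} (h : Fin n → Fin m) : Set where
    field
      proper          : Proper G h
      classDominating : ClassDominating h
      missed          : ∃[ c ] Missed h c
      otherClass      : ¬ TwoMissed h → ∃[ y₀ ] OtherClassDominated h y₀

  record SmallerTDC (m : ℕ) : Set where
    field
      size             : ℕ
      colouring        : Fin n → Fin size
      isTDC            : IsTDC G colouring
      size<m           : size < m
      tight⇒no-private : m ≡ suc size → ∃[ i ] (∀ v → ¬ PrivNbr G colouring i v)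

  shrink : ∀ {m} {h : Fin n → Fin m} → InheritedColouring h → SmallerTDC m
  shrink {m} {h} H = record
    { size = size ; colouring = onto
    ; isTDC = onto-surjective , proper-onto , dominating-onto
    ; size<m = let (c , c∉h) = missed in injective-missing⇒< into-injective c (into-misses c∉h)
    ; tight⇒no-private = no-private
    }
    where
    open ImageFactorisation (imageFactorisation h)
    open InheritedColouring H

    onto⇒h : ∀ x y → onto x ≡ onto y → h x ≡ h y
    onto⇒h x y eq = trans (≡-sym (into∘onto x)) (trans (cong into eq) (into∘onto y))

    proper-onto : Proper G onto
    proper-onto x y x~y eq = proper x y x~y (onto⇒h x y eq)

    dominates-onto : ∀ v y → Dom G h v (h y) → Dom G onto v (onto y)
    dominates-onto v y d x eq = d x (onto⇒h x y eq)

    dominating-onto : ∀ v → ∃[ i ] Dom G onto v i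
    dominating-onto v with classDominating v
    ... | y , d = onto y , dominates-onto v y d

    into-misses : ∀ {c} → Missed h c → ∀ i → c ≢ into i
    into-misses c∉h i c≡into with onto-surjective i
    ... | x , refl = c∉h x (≡-sym (trans c≡into (into∘onto x)))

    no-private : m ≡ suc size → ∃[ i ] (∀ v → ¬ PrivNbr G onto i v)
    no-private m≡1+size with otherClass ¬twoMissed
      where
      ¬twoMissed : ¬ TwoMissed h
      ¬twoMissed (_ , _ , c₁≢c₂ , c₁∉h , c₂∉h) = <-irrefl (≡-sym m≡1+size)
        (injective-missing-two⇒< into-injective c₁≢c₂ (into-misses c₁∉h) (into-misses c₂∉h))
    ... | y₀ , elsewhere = onto y₀ , no-private-of-y₀
      where
      no-private-of-y₀ : ∀ v → ¬ PrivNbr G onto (onto y₀) v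
      no-private-of-y₀ v (_ , unique) with elsewhere v
      ... | y , hy≢hy₀ , d = unique (onto y) (hy≢hy₀ ∘ onto⇒h y y₀) (dominates-onto v y d)

module Mycielskian {n : ℕ} (G : Graph n) where

  _≈_ : MV n → MV n → Set
  a ≈ b = myAdj G a b ≡ true

  embed : MV n → Fin (n + (n + 1))
  embed (vv i) = i ↑ˡ (n + 1)
  embed (uu j) = n ↑ʳ (j ↑ˡ 1)
  embed ww     = n ↑ʳ (n ↑ʳ zero)

  classify-embed : ∀ a → classify (embed a) ≡ a
  classify-embed (vv i) rewrite Finₚ.splitAt-↑ˡ n i (n + 1) = refl
  classify-embed (uu j) rewrite Finₚ.splitAt-↑ʳ n (n + 1) (j ↑ˡ 1) | Finₚ.splitAt-↑ˡ n j 1 = refl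
  classify-embed ww rewrite Finₚ.splitAt-↑ʳ n (n + 1) (n ↑ʳ zero) | Finₚ.splitAt-↑ʳ n 1 (zero {0}) = refl

  embed-classify : ∀ x → embed (classify x) ≡ x
  embed-classify x with splitAt n x | Finₚ.join-splitAt n (n + 1) x
  ... | inj₁ i | eq = eq
  ... | inj₂ y | eq with splitAt n {1} y | Finₚ.join-splitAt n 1 y
  ...   | inj₁ j    | eq′ = trans (cong (n ↑ʳ_) eq′) eq
  ...   | inj₂ zero | eq′ = trans (cong (n ↑ʳ_) eq′) eq

  module Coloured {m : ℕ} (col : MV n → Fin m) where

    _≻_ : MV n → Fin m → Set
    a ≻ i = ∀ b → col b ≡ i → a ≈ b

    record IsTDCᴹ : Set where
      field
        surjective : ∀ i → ∃[ a ] (col a ≡ i)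
        proper     : ∀ a b → a ≈ b → col a ≢ col b
        dominating : ∀ a → ∃[ i ] (a ≻ i)

  open Coloured public

  fromTDC : ∀ {m} {g : Fin (n + (n + 1)) → Fin m} → IsTDC (M G) g → IsTDCᴹ (g ∘ embed)
  fromTDC {g = g} (surjective , proper , dominating) = record
    { surjective = λ i → let (x , gx≡i) = surjective i in classify x , trans (cong g (embed-classify x)) gx≡i
    ; proper     = λ a b a≈b → proper (embed a) (embed b) (adjacent-embed a b a≈b)
    ; dominating = λ a → let (i , d) = dominating (embed a) in i , λ b gb≡i → adjacent-classify a b (d (embed b) gb≡i)
    }
    where
    adjacent-embed : ∀ a b → a ≈ b → classify (embed a) ≈ classify (embed b)
    adjacent-embed a b = subst₂ _≈_ (≡-sym (classify-embed a)) (≡-sym (classify-embed b))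
    adjacent-classify : ∀ a b → classify (embed a) ≈ classify (embed b) → a ≈ b
    adjacent-classify a b = subst₂ _≈_ (classify-embed a) (classify-embed b)

  toTDC : ∀ {m} {col : MV n → Fin m} → IsTDCᴹ col → HasTDC (M G) m
  toTDC {col = col} T = col ∘ classify , surjective′ , (λ x y → proper (classify x) (classify y)) , dominating′
    where
    open IsTDCᴹ T
    surjective′ : ∀ i → ∃[ x ] (col (classify x) ≡ i)
    surjective′ i with surjective i
    ... | a , col-a≡i = embed a , trans (cong col (classify-embed a)) col-a≡i
    dominating′ : ∀ x → ∃[ i ] Dom (M G) (col ∘ classify) x i
    dominating′ x with dominating (classify x)
    ... | i , d = i , λ y → d (classify y)

false≢true : false ≢ true
false≢true ()

module _ {n : ℕ} (G : Graph n) where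
  open Mycielskian G using (_≈_; module Coloured; toTDC)

  dominates? : ∀ {k} (f : Fin n → Fin k) v j → Dec (Dom G f v j)
  dominates? f v j = Finₚ.all? (λ x → (f x Finₚ.≟ j) →-dec (Adj G v x Boolₚ.≟ true))

  dominates-another : ∀ {k} {f : Fin n → Fin k} → IsTDC G f → {i : Fin k} →
                      (∀ v → ¬ PrivNbr G f i v) → ∀ v → ∃[ j ] (j ≢ i × Dom G f v j)
  dominates-another {f = f} (_ , _ , dominating) {i} no-private v with dominating v
  ... | j , v≻j with j Finₚ.≟ i
  ...   | no j≢i = j , j≢i , v≻j
  ...   | yes refl with Finₚ.any? (λ j → ¬? (j Finₚ.≟ i) ×-dec dominates? f v j)
  ...     | yes other = other
  ...     | no ¬other = ⊥-elim (no-private v (v≻j , λ j j≢i v≻j → ¬other (j , j≢i , v≻j)))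

  mycielskian-upper-bound : ∀ {k} {f : Fin n → Fin k} → IsTDC G f → (i : Fin k) →
                            (∀ v → ¬ PrivNbr G f i v) → HasTDC (M G) (suc k)
  mycielskian-upper-bound {k} {f} tdc@(surjective , proper , _) i no-private =
    toTDC record { surjective = surjective′ ; proper = proper′ ; dominating = dominating′ }
    where
    col : MV n → Fin (suc k)
    col (vv x) = suc (f x)
    col (uu x) = zero
    col ww     = suc i

    open Coloured col using (_≻_)

    surjective′ : ∀ c → ∃[ a ] (col a ≡ c)
    surjective′ zero    = uu (proj₁ (surjective i)) , refl
    surjective′ (suc j) with surjective j
    ... | y , refl = vv y , refl

    proper′ : ∀ a b → a ≈ b → col a ≢ col b
    proper′ (vv x) (vv y) x~y eq = proper x y x~y (Finₚ.suc-injective eq)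
    proper′ (vv x) (uu y) _   ()
    proper′ (uu x) (vv y) _   ()
    proper′ (uu x) ww     _   ()
    proper′ ww     (uu y) _   ()
    proper′ (vv x) ww     ()
    proper′ (uu x) (uu y) ()
    proper′ ww     (vv y) ()
    proper′ ww     ww     ()

    lifts-domination : ∀ {x j} → j ≢ i → Dom G f x j → ∀ b → col b ≡ suc j → vv x ≈ b × uu x ≈ b
    lifts-domination _   x≻j (vv y) eq = x≻j y (Finₚ.suc-injective eq) , x≻j y (Finₚ.suc-injective eq)
    lifts-domination j≢i _   ww     eq = ⊥-elim (j≢i (≡-sym (Finₚ.suc-injective eq)))

    dominating′ : ∀ a → ∃[ c ] (a ≻ c)
    dominating′ (vv x) with dominates-another tdc no-private x
    ... | j , j≢i , x≻j = suc j , λ b eq → proj₁ (lifts-domination j≢i x≻j b eq)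
    dominating′ (uu x) with dominates-another tdc no-private x
    ... | j , j≢i , x≻j = suc j , λ b eq → proj₂ (lifts-domination j≢i x≻j b eq)
    dominating′ ww = zero , λ { (uu y) _ → refl }

module LowerBound {n : ℕ} (G : Graph n) {m : ℕ} {col : MV n → Fin m} (T : Mycielskian.IsTDCᴹ G col) where
  open Mycielskian G using (_≈_; module Coloured)
  open Coloured col using (_≻_)
  open Mycielskian.IsTDCᴹ T

  data Occupant (i : Fin m) : Set where
    v-occupant : ∀ y → col (vv y) ≡ i → Occupant i
    u-occupant : Missed G (col ∘ vv) i → ∀ y → col (uu y) ≡ i → Occupant i
    w-occupant : Missed G (col ∘ vv) i → col ww ≡ i → Occupant i

  occupant : ∀ i → Occupant i
  occupant i with Finₚ.any? (λ y → col (vv y) Finₚ.≟ i)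
  ... | yes (y , eq) = v-occupant y eq
  ... | no ¬v with surjective i
  ...   | vv y , eq = ⊥-elim (¬v (y , eq))
  ...   | uu y , eq = u-occupant (λ y eq → ¬v (y , eq)) y eq
  ...   | ww   , eq = w-occupant (λ y eq → ¬v (y , eq)) eq

  w≻i⇒no-v : ∀ {i} → ww ≻ i → Missed G (col ∘ vv) i
  w≻i⇒no-v w≻i y eq = false≢true (w≻i (vv y) eq)

  w≻i⇒no-w : ∀ {i} → ww ≻ i → col ww ≢ i
  w≻i⇒no-w w≻i eq = false≢true (w≻i ww eq)

  u≻i⇒no-u : ∀ {j i} → uu j ≻ i → ∀ y → col (uu y) ≢ i
  u≻i⇒no-u u≻i y eq = false≢true (u≻i (uu y) eq)

  v≻i⇒no-w : ∀ {j i} → vv j ≻ i → col ww ≢ i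
  v≻i⇒no-w v≻i eq = false≢true (v≻i ww eq)

  v≻i⇒no-own-u : ∀ {j i} → vv j ≻ i → col (uu j) ≢ i
  v≻i⇒no-own-u {j} v≻i eq = false≢true (trans (≡-sym (irrefl G j)) (v≻i (uu j) eq))

  restrict-u : ∀ {j i} → uu j ≻ i → Dom G (col ∘ vv) j i
  restrict-u u≻i x eq = u≻i (vv x) eq

  restrict-v : ∀ {j i} → vv j ≻ i → Dom G (col ∘ vv) j i
  restrict-v v≻i x eq = v≻i (vv x) eq

  module ColourOfWShared (s : Fin n) (s≡w : col (vv s) ≡ col ww) where

    u-dominates-v-class : ∀ j → ∃[ y ] (uu j ≻ col (vv y))
    u-dominates-v-class j with dominating (uu j)
    ... | i , uj≻i with occupant i
    ...   | v-occupant y refl    = y , uj≻i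
    ...   | u-occupant _ y eq    = ⊥-elim (u≻i⇒no-u uj≻i y eq)
    ...   | w-occupant no-v eq   = ⊥-elim (no-v s (trans s≡w eq))

    -- If u_l and v_y₀ share a colour, no u_j dominates that colour, so every class dominated by a u_j will do.
    u-shares⇒other-class : ∀ {l y₀} → col (uu l) ≡ col (vv y₀) → OtherClassDominated G (col ∘ vv) y₀
    u-shares⇒other-class {l} u≡v j with u-dominates-v-class j
    ... | y , uj≻y = y , (λ eq → u≻i⇒no-u uj≻y l (trans u≡v (≡-sym eq))) , restrict-u uj≻y

    -- Otherwise a v_j dominating a class without v's would leave it and col (u_j) as two missed colours.
    u-unshared⇒other-class : (∀ l y → col (uu l) ≢ col (vv y)) → ¬ TwoMissed G (col ∘ vv) →
                             OtherClassDominated G (col ∘ vv) s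
    u-unshared⇒other-class u-unshared ¬two j with dominating (vv j)
    ... | i , vj≻i with occupant i
    ...   | v-occupant y refl = y , (λ eq → v≻i⇒no-w vj≻i (trans (≡-sym s≡w) (≡-sym eq))) , restrict-v vj≻i
    ...   | w-occupant _ eq   = ⊥-elim (v≻i⇒no-w vj≻i eq)
    ...   | u-occupant no-v _ _ =
      ⊥-elim (¬two (i , col (uu j) , (λ eq → v≻i⇒no-own-u vj≻i (≡-sym eq)) , no-v , λ y eq → u-unshared j y (≡-sym eq)))

    inherited : InheritedColouring G (col ∘ vv)
    inherited = record
      { proper          = λ x y → proper (vv x) (vv y)
      ; classDominating = λ j → let (y , uj≻y) = u-dominates-v-class j in y , restrict-u uj≻y
      ; missed          = let (c , w≻c) = dominating ww in c , w≻i⇒no-v w≻c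
      ; otherClass      = otherClass
      }
      where
      otherClass : ¬ TwoMissed G (col ∘ vv) → ∃[ y₀ ] OtherClassDominated G (col ∘ vv) y₀
      otherClass ¬two with Finₚ.any? (λ l → Finₚ.any? (λ y → col (uu l) Finₚ.≟ col (vv y)))
      ... | yes (_ , y₀ , u≡v) = y₀ , u-shares⇒other-class u≡v
      ... | no ¬shared = s , u-unshared⇒other-class (λ l y eq → ¬shared (l , y , eq)) ¬two

  module ColourOfWUnshared (w-unshared : Missed G (col ∘ vv) (col ww)) where

    chosenU : Fin m → Maybe (Fin n)
    chosenU i with Finₚ.any? (λ y → col (uu y) Finₚ.≟ i)
    ... | yes (r , _) = just r
    ... | no _        = nothing

    chosenU-colour : ∀ {i r} → chosenU i ≡ just r → col (uu r) ≡ i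
    chosenU-colour {i} eq with Finₚ.any? (λ y → col (uu y) Finₚ.≟ i)
    chosenU-colour refl | yes (_ , col≡i) = col≡i

    chosenU-defined : ∀ {i y} → col (uu y) ≡ i → ∃[ r ] (chosenU i ≡ just r)
    chosenU-defined {i} {y} col≡i with Finₚ.any? (λ y → col (uu y) Finₚ.≟ i)
    ... | yes (r , _) = r , refl
    ... | no ¬u       = ⊥-elim (¬u (y , col≡i))

    -- Only one r per colour: two u's of one colour may have adjacent v's.
    IsRep : Fin n → Set
    IsRep r = Missed G (col ∘ vv) (col (uu r)) × chosenU (col (uu r)) ≡ just r

    isRep? : ∀ r → Dec (IsRep r)
    isRep? r = Finₚ.all? (λ y → ¬? (col (vv y) Finₚ.≟ col (uu r)))
               ×-dec Maybeₚ.≡-dec Finₚ._≟_ (chosenU (col (uu r))) (just r)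

    h : Fin n → Fin m
    h y with isRep? y
    ... | yes _ = col (uu y)
    ... | no _  = col (vv y)

    data Recoloured (y : Fin n) : Fin m → Set where
      representative : IsRep y → Recoloured y (col (uu y))
      unchanged      : ¬ IsRep y → Recoloured y (col (vv y))

    recoloured : ∀ y → Recoloured y (h y)
    recoloured y with isRep? y
    ... | yes r = representative r
    ... | no ¬r = unchanged ¬r

    rep-unique : ∀ {x y} → IsRep x → IsRep y → col (uu x) ≡ col (uu y) → x ≡ y
    rep-unique (_ , chosen-x) (_ , chosen-y) eq =
      Maybeₚ.just-injective (trans (≡-sym chosen-x) (trans (cong chosenU eq) chosen-y))

    rep-exists : ∀ {i z} → Missed G (col ∘ vv) i → col (uu z) ≡ i → ∃[ r ] (IsRep r × col (uu r) ≡ i)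
    rep-exists {i} no-v col≡i with chosenU-defined col≡i
    ... | r , chosen with chosenU-colour chosen
    ...   | refl = r , (no-v , chosen) , refl

    h-rep : ∀ {r} → IsRep r → h r ≡ col (uu r)
    h-rep {r} rr with h r | recoloured r
    ... | _ | representative _ = refl
    ... | _ | unchanged ¬rr    = ⊥-elim (¬rr rr)

    h-unchanged : ∀ {y} → ¬ IsRep y → h y ≡ col (vv y)
    h-unchanged {y} ¬ry with h y | recoloured y
    ... | _ | representative ry = ⊥-elim (¬ry ry)
    ... | _ | unchanged _       = refl

    rep-class : ∀ {r x} → IsRep r → h x ≡ h r → x ≡ r
    rep-class {r} {x} rr eq with h x | recoloured x | h-rep rr
    ... | _ | representative rx | hr = rep-unique rx rr (trans eq hr)
    ... | _ | unchanged _       | hr = ⊥-elim (proj₁ rr x (trans eq hr))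

    h-into-v-colour : ∀ {x y} → h x ≡ col (vv y) → col (vv x) ≡ col (vv y)
    h-into-v-colour {x} {y} eq with h x | recoloured x
    ... | _ | representative rx = ⊥-elim (proj₁ rx y (≡-sym eq))
    ... | _ | unchanged _       = eq

    dominates-rep-class : ∀ {j r} → IsRep r → Adj G j r ≡ true → Dom G h j (h r)
    dominates-rep-class {j} rr j~r x eq = subst (λ x → Adj G j x ≡ true) (≡-sym (rep-class rr eq)) j~r

    dominates-v-class : ∀ {j y} → vv j ≻ col (vv y) → Dom G h j (col (vv y))
    dominates-v-class vj≻y x eq = vj≻y (vv x) (h-into-v-colour eq)

    v-dominates : ∀ {j i} → vv j ≻ i → ∃[ y ] (Dom G h j (h y) × (IsRep y ⊎ h y ≡ i))
    v-dominates {j} {i} vj≻i with occupant i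
    ... | w-occupant _ eq = ⊥-elim (v≻i⇒no-w vj≻i eq)
    ... | u-occupant no-v _ col≡i with rep-exists no-v col≡i
    ...   | r , rr , refl = r , dominates-rep-class rr (trans (Graph.sym G j r) (vj≻i (uu r) refl)) , inj₁ rr
    v-dominates {j} vj≻i | v-occupant y refl with isRep? y
    ...   | yes ry = y , dominates-rep-class ry (vj≻i (vv y) refl) , inj₁ ry
    ...   | no ¬ry = y , subst (Dom G h j) (≡-sym (h-unchanged ¬ry)) (dominates-v-class vj≻i) , inj₂ (h-unchanged ¬ry)

    proper-h : Proper G h
    proper-h x y x~y eq with h x | recoloured x | h y | recoloured y
    ... | _ | representative rx | _ | representative ry = no-loop (rep-unique rx ry eq) x~y
      where
      no-loop : ∀ {x y} → x ≡ y → Adj G x y ≡ true → ⊥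
      no-loop {x} refl x~x = false≢true (trans (≡-sym (irrefl G x)) x~x)
    ... | _ | representative _ | _ | unchanged _      = proper (uu x) (vv y) x~y eq
    ... | _ | unchanged _      | _ | representative _ = proper (vv x) (uu y) (trans (Graph.sym G y x) x~y) eq
    ... | _ | unchanged _      | _ | unchanged _      = proper (vv x) (vv y) x~y eq

    w-missed : Missed G h (col ww)
    w-missed y eq with h y | recoloured y
    ... | _ | representative _ = proper (uu y) ww refl eq
    ... | _ | unchanged _      = w-unshared y eq

    rep-avoids-v : ∀ {y} → IsRep y → ∀ x → h y ≢ col (vv x)
    rep-avoids-v ry x eq = proj₁ ry x (≡-sym (trans (≡-sym (h-rep ry)) eq))

    some-rep : ∃[ r ] IsRep r
    some-rep with dominating ww
    ... | a , w≻a with occupant a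
    ...   | v-occupant y eq         = ⊥-elim (w≻i⇒no-v w≻a y eq)
    ...   | w-occupant _ eq         = ⊥-elim (w≻i⇒no-w w≻a eq)
    ...   | u-occupant no-v _ col≡a = let (r , rr , _) = rep-exists no-v col≡a in r , rr

    -- A v_j dominating the class col (v_x) of a representative x is adjacent to x, whose own h-class is {x}.
    other-class : ∀ {x y₀} → IsRep x → h y₀ ≡ col (vv x) → OtherClassDominated G h y₀
    other-class {x} rx hy₀ j with dominating (vv j)
    ... | i , vj≻i with v-dominates vj≻i
    ...   | y , j≻y , inj₁ ry = y , (λ eq → rep-avoids-v ry x (trans eq hy₀)) , j≻y
    ...   | y , j≻y , inj₂ hy≡i with i Finₚ.≟ col (vv x)
    ...     | no i≢vx = y , (λ eq → i≢vx (trans (≡-sym hy≡i) (trans eq hy₀))) , j≻y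
    ...     | yes refl = x , (λ eq → rep-avoids-v rx x (trans eq hy₀)) , dominates-rep-class rx (vj≻i (vv x) refl)

    inherited : InheritedColouring G h
    inherited = record
      { proper          = proper-h
      ; classDominating = λ j → let (y , j≻y , _) = v-dominates (proj₂ (dominating (vv j))) in y , j≻y
      ; missed          = col ww , w-missed
      ; otherClass      = otherClass
      }
      where
      otherClass : ¬ TwoMissed G h → ∃[ y₀ ] OtherClassDominated G h y₀
      otherClass ¬two with some-rep
      ... | x , rx with Finₚ.any? (λ y → h y Finₚ.≟ col (vv x))
      ...   | yes (y₀ , hy₀) = y₀ , other-class rx hy₀
      ...   | no ¬hit = ⊥-elim (¬two (col ww , col (vv x) , (λ eq → w-unshared x (≡-sym eq)) , w-missed , λ y eq → ¬hit (y , eq)))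

  inheritedColouring : ∃[ h ] InheritedColouring G h
  inheritedColouring with Finₚ.any? (λ y → col (vv y) Finₚ.≟ col ww)
  ... | yes (s , s≡w) = col ∘ vv , ColourOfWShared.inherited s s≡w
  ... | no ¬shared    = ColourOfWUnshared.h (λ y eq → ¬shared (y , eq)) , ColourOfWUnshared.inherited _

mycielskian-lower-bound : ∀ {n m} (G : Graph n) {g : Fin (n + (n + 1)) → Fin m} → IsTDC (M G) g → SmallerTDC G m
mycielskian-lower-bound G tdc = shrink G (proj₂ (LowerBound.inheritedColouring G (Mycielskian.fromTDC G tdc)))

module _ {n : ℕ} (G : Graph n) where

  χ-minimal : ∀ {k m} → IsChiDT G k → HasTDC G m → k ≤ m
  χ-minimal (_ , minimal) tdc = ≮⇒≥ (λ m<k → minimal _ m<k tdc)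

  χ-unique : ∀ {k k₁} → IsChiDT G k → IsChiDT G k₁ → k ≡ k₁
  χ-unique χk χk₁ = ≤-antisym (χ-minimal χk (proj₁ χk₁)) (χ-minimal χk₁ (proj₁ χk))

-- δ(G) ≥ 1 only guarantees that χ_d^t(G) exists, which is assumed anyway.
theorem2p3 : (n : ℕ) (G : Graph n) → MinDegPos G →
    (k k' : ℕ) → IsChiDT G k → IsChiDT (M G) k' →
    (Class1 G ⇔ (k' ≡ k + 1))
theorem2p3 n G _ k k' χG χMG = mk⇔ class1⇒ ⇒class1
  where
  open SmallerTDC (mycielskian-lower-bound G (proj₂ (proj₁ χMG)))

  k≤size : k ≤ size
  k≤size = χ-minimal G χG (colouring , isTDC)

  class1⇒ : Class1 G → k' ≡ k + 1
  class1⇒ (k₁ , χk₁ , f , tdc , i , no-private) with χ-unique G χk₁ χG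
  ... | refl = trans (≤-antisym k'≤1+k (≤-<-trans k≤size size<m)) (+-comm 1 k)
    where
    k'≤1+k : k' ≤ suc k
    k'≤1+k = χ-minimal (M G) χMG (mycielskian-upper-bound G tdc i no-private)

  ⇒class1 : k' ≡ k + 1 → Class1 G
  ⇒class1 k'≡k+1 = size , subst (IsChiDT G) k≡size χG , colouring , isTDC , tight⇒no-private k'≡1+size
    where
    k'≡1+k : k' ≡ suc k
    k'≡1+k = trans k'≡k+1 (+-comm k 1)
    k≡size : k ≡ size
    k≡size = ≤-antisym k≤size (≤-pred (subst (size <_) k'≡1+k size<m))
    k'≡1+size : k' ≡ suc size
    k'≡1+size = trans k'≡1+k (cong suc k≡size)
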